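{- For positive integers $n$ and non-negative integers $T,E$, let $G_n[T,E]$ denote the number of sequences $(s_1,\dots,s_n)$ of non-negative integers such that $s_1\le s_2\le\cdots\le s_n$, $\sum_{i=1}^r s_i>\binom{r}{2}$ for all $1\le r<n$, $s_n=E$, and $\sum_{i=1}^n s_i=T$. Let $SSCS(n)$ denote the number of score sequences of length $n$ that are both strong and self-complementary. Then for all $m\ge1$, $$SSCS(2m)=\sum_{T=\binom m2+1}^{m(m-1)}\ \sum_{E=\lceil T/m\rceil}^{m-1} G_m[T,E],$$ and $$SSCS(2m+1)=\sum_{T=\binom m2+1}^{m^2}\ \sum_{E=\lceil T/m\rceil}^{m} G_m[T,E],$$ where empty sums are $0$.
   Context: A score sequence of length $n\ge1$ is a sequence $(s_1,\dots,s_n)$ of non-negative integers with $s_1\le\cdots\le s_n$, $\sum_{i=1}^r s_i\ge\binom r2$ for $1\le r<n$ and $\sum_{i=1}^n s_i=\binom n2$ (equivalently, the nondecreasing out-degree sequence of a tournament on $n$ vertices). It is strong if $\sum_{i=1}^r s_i>\binom r2$ for all $1\le r<n$, and self-complementary if $s_{n+1-i}=n-1-s_i$ for all $1\le i\le\lfloor n/2\rfloor$. -}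

module Defs where

open import Data.Nat using (ℕ; zero; suc; _+_; _*_; _∸_; _≤_; _<_; _/_; NonZero; _≤?_; _<?_; s≤s; z≤n)
open import Data.Nat.Properties using (_≟_; ≤-refl; m≤n⇒m<n∨m≡n)
open import Data.Nat.Combinatorics using (_C_)
open import Data.Nat.ListAction using (sum)
open import Data.List using (List; []; _∷_; length; take; map; upTo; concatMap; filter; reverse)
open import Data.List.Relation.Unary.Linked using (Linked; linked?)
open import Data.Product using (_×_; _,_; proj₁; proj₂)
open import Data.Sum using (inj₁; inj₂)
open import Relation.Nullary using (Dec; yes; no; ¬_)
open import Relation.Nullary.Decidable using (_×-dec_; _→-dec_)
open import Relation.Unary using (Decidable)
open import Relation.Binary.PropositionalEquality using (_≡_; refl)

-- s at i  = s_i  (1-based; default 0 outside 1..length, never used there)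
_at_ : List ℕ → ℕ → ℕ
[]       at i             = 0
(x ∷ xs) at zero          = 0
(x ∷ xs) at suc zero      = x
(x ∷ xs) at suc (suc i)   = xs at suc i

psum : ℕ → List ℕ → ℕ
psum r s = sum (take r s)

All[1≤_<_]_ : ℕ → ℕ → (ℕ → Set) → Set
All[1≤ a < n ] P = ∀ r → a ≤ r → r < n → P r

private
  all<? : (P : ℕ → Set) → Decidable P → (a n : ℕ) → Dec (All[1≤ a < n ] P)
  all<? P P? a zero = yes (λ r _ ())
  all<? P P? a (suc n) with all<? P P? a n | a ≤? n | P? n
  ... | no ¬h | _ | _ = no (λ h → ¬h (λ r a≤r r<n → h r a≤r (Data.Nat.Properties.m<n⇒m<1+n r<n)))
    where import Data.Nat.Properties
  ... | yes h | no a≰n | _ = yes λ r a≤r r<1+n → lemma r a≤r r<1+n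
    where
      lemma : ∀ r → a ≤ r → r < suc n → P r
      lemma r a≤r (s≤s r≤n) with m≤n⇒m<n∨m≡n r≤n
      ... | inj₁ r<n = h r a≤r r<n
      ... | inj₂ refl = Relation.Nullary.contradiction a≤r a≰n
        where import Relation.Nullary
  ... | yes h | yes a≤n | yes pn = yes lemma
    where
      lemma : ∀ r → a ≤ r → r < suc n → P r
      lemma r a≤r (s≤s r≤n) with m≤n⇒m<n∨m≡n r≤n
      ... | inj₁ r<n = h r a≤r r<n
      ... | inj₂ refl = pn
  ... | yes h | yes a≤n | no ¬pn = no (λ h' → ¬pn (h' n a≤n ≤-refl))

NonDecreasing : List ℕ → Set
NonDecreasing = Linked _≤_

ScoreSeq : ℕ → List ℕ → Set
ScoreSeq n s = length s ≡ n × NonDecreasing s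
             × All[1≤ 1 < n ] (λ r → r C 2 ≤ psum r s)
             × sum s ≡ n C 2

Strong : ℕ → List ℕ → Set
Strong n s = All[1≤ 1 < n ] (λ r → r C 2 < psum r s)

-- self-complementary: s_{n+1-i} = n-1-s_i for 1 ≤ i ≤ ⌊n/2⌋
-- (stated additively, s_{n+1-i} + s_i = n - 1, to avoid truncated subtraction)
SelfComp : ℕ → List ℕ → Set
SelfComp n s = All[1≤ 1 < suc (n / 2) ] (λ i → s at (n + 1 ∸ i) + s at i ≡ n ∸ 1)

GCond : ℕ → ℕ → ℕ → List ℕ → Set
GCond n T E s = length s ≡ n × NonDecreasing s
              × All[1≤ 1 < n ] (λ r → r C 2 < psum r s)
              × s at n ≡ E × sum s ≡ T

scoreSeq? : ∀ n → Decidable (ScoreSeq n)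
scoreSeq? n s = (length s ≟ n) ×-dec (linked? _≤?_ s
  ×-dec (all<? _ (λ r → r C 2 ≤? psum r s) 1 n ×-dec (sum s ≟ n C 2)))

strong? : ∀ n → Decidable (Strong n)
strong? n s = all<? _ (λ r → r C 2 <? psum r s) 1 n

selfComp? : ∀ n → Decidable (SelfComp n)
selfComp? n s = all<? _ (λ i → s at (n + 1 ∸ i) + s at i ≟ n ∸ 1) 1 (suc (n / 2))

gCond? : ∀ n T E → Decidable (GCond n T E)
gCond? n T E s = (length s ≟ n) ×-dec (linked? _≤?_ s
  ×-dec (all<? _ (λ r → r C 2 <? psum r s) 1 n ×-dec ((s at n ≟ E) ×-dec (sum s ≟ T))))

lists≤ : ℕ → ℕ → List (List ℕ)
lists≤ B zero    = [] ∷ []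
lists≤ B (suc n) = concatMap (λ x → map (x ∷_) (lists≤ B n)) (upTo (suc B))

count : ∀ {P : List ℕ → Set} → Decidable P → ℕ → ℕ → ℕ
count P? n B = length (filter P? (lists≤ B n))

-- G_n[T,E]: every admissible sequence has entries ≤ its sum T,
-- so enumerating entries in {0..T} counts all of them.
G : ℕ → ℕ → ℕ → ℕ
G n T E = count (gCond? n T E) n T

-- SSCS(n): entries of a score sequence are ≤ its sum C(n,2).
SSCS : ℕ → ℕ
SSCS n = count (λ s → scoreSeq? n s ×-dec (strong? n s ×-dec selfComp? n s)) n (n C 2)

-- ∑_{k=a}^{b} f k  (empty, i.e. 0, when b < a)
∑[_to_] : ℕ → ℕ → (ℕ → ℕ) → ℕ
∑[ a to b ] f = sum (map (λ j → f (a + j)) (upTo (suc b ∸ a)))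

⌈_/_⌉ : ℕ → (m : ℕ) → .{{NonZero m}} → ℕ
⌈ t / m ⌉ = (t + m ∸ 1) / m

{-# OPTIONS --safe #-}
module Submission where

-- A strong self-complementary score sequence t of length n = 2m or 2m + 1 is determined by
-- its first half s = (t₁, …, t_m): self-complementarity forces t_{n+1-i} = n - 1 - t_i, and
-- when n is odd the total C(n,2) forces the middle entry to be m.  Conversely the completion
-- of a nondecreasing s is a strong score sequence exactly when s is strong up to r = m and
-- s_m ≤ ⌊(n-1)/2⌋: for r > m the symmetry gives
--   ∑_{i≤r} t_i = C(n,2) - (n-r)(n-1) + ∑_{i≤n-r} t_i,
-- which reduces strength at r to strength at n - r ≤ m.  Sorting the halves by their sum T
-- and last entry E yields the double sum of G_m[T,E]; the bound E ≥ ⌈T/m⌉ is automatic.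

open import Defs
open import Data.Nat using (ℕ; zero; suc; _+_; _*_; _∸_; _≤_; _<_; _≤?_; _<?_; s≤s; z≤n; ⌊_/2⌋; _/_; NonZero)
open import Data.Nat.Properties
open import Data.Nat.DivMod using (m<n*o⇒m/o<n; m*n/n≡m; /-monoˡ-≤)
open import Data.Nat.ListAction using (sum)
open import Data.Nat.Combinatorics using (_C_; nCk+nC[k+1]≡[n+1]C[k+1]; nC1≡n)
open import Data.Nat.Tactic.RingSolver using (solve-∀)
open import Data.List using (List; []; _∷_; length; take; map; upTo; applyUpTo; filter; _++_; concatMap; cartesianProductWith)
open import Data.List.Properties using (length-++; ∷-injective; map-upTo; map-cong; length-applyUpTo; length-take; take-all; take-take)
open import Data.List.Membership.Propositional using (_∈_)
open import Data.List.Membership.Propositional.Properties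
  using (∈-∃++; ∈-++⁻; ∈-++⁺ˡ; ∈-++⁺ʳ; ∈-filter⁺; ∈-filter⁻; ∈-upTo⁺; ∈-upTo⁻;
         ∈-cartesianProductWith⁺; ∈-cartesianProductWith⁻)
open import Data.List.Relation.Unary.Any using (here; there)
open import Data.List.Relation.Unary.All as All using (All; []; _∷_)
open import Data.List.Relation.Unary.All.Properties using (All¬⇒¬Any)
open import Data.List.Relation.Unary.AllPairs using ([]; _∷_)
open import Data.List.Relation.Unary.Linked using ([]; [-]; _∷_)
open import Data.List.Relation.Unary.Linked.Properties using (applyUpTo⁺₁; AllPairs⇒Linked; Linked⇒AllPairs)
import Data.List.Relation.Unary.AllPairs.Properties as AllPairs
open import Data.List.Relation.Unary.Unique.Propositional using (Unique)
import Data.List.Relation.Unary.Unique.Propositional.Properties as Unique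
open import Data.Product using (_×_; _,_; proj₁; proj₂)
open import Data.Sum using (inj₁; inj₂)
open import Data.Empty using (⊥-elim)
open import Function using (_∘_; id)
open import Relation.Nullary using (Dec; yes; no; ¬_; contradiction)
open import Relation.Nullary.Decidable using (_×-dec_)
open import Relation.Unary using (Decidable)
open import Relation.Binary.PropositionalEquality

private
  variable
    A B : Set

+-double-injective : ∀ {x y} → x + x ≡ y + y → x ≡ y
+-double-injective {x} {y} eq = trans (n≡⌊n+n/2⌋ x) (trans (cong ⌊_/2⌋ eq) (sym (n≡⌊n+n/2⌋ y)))

+-double-≤⇒≤ : ∀ {x y} → x + x ≤ suc (y + y) → x ≤ y
+-double-≤⇒≤ {x} {y} le = subst₂ _≤_ (sym (n≡⌊n+n/2⌋ x)) (sym (n≡⌈n+n/2⌉ y)) (⌊n/2⌋-mono le)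

/-between : ∀ {x q} d .{{_ : NonZero d}} → q * d ≤ x → x < suc q * d → x / d ≡ q
/-between {x} {q} d qd≤x x<[1+q]d =
  ≤-antisym (≤-pred (m<n*o⇒m/o<n x<[1+q]d)) (subst (_≤ x / d) (m*n/n≡m q d) (/-monoˡ-≤ d qd≤x))

⌈/⌉≤ : ∀ {T E} k → T ≤ suc k * E → ⌈ T / suc k ⌉ ≤ E
⌈/⌉≤ {T} {E} k T≤ = ≤-pred (m<n*o⇒m/o<n (begin-strict
  T + suc k ∸ 1     ≡⟨ cong (_∸ 1) (+-suc T k) ⟩
  T + k             ≤⟨ +-monoˡ-≤ k (subst (T ≤_) (*-comm (suc k) E) T≤) ⟩
  E * suc k + k     <⟨ +-monoʳ-< (E * suc k) (n<1+n k) ⟩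
  E * suc k + suc k ≡⟨ +-comm (E * suc k) (suc k) ⟩
  suc E * suc k     ∎))
  where open ≤-Reasoning

C2-suc : ∀ n → suc n C 2 ≡ n + n C 2
C2-suc n = trans (sym (nCk+nC[k+1]≡[n+1]C[k+1] n 1)) (cong (_+ n C 2) (nC1≡n n))

C2-double : ∀ n → suc n C 2 + suc n C 2 ≡ suc n * n
C2-double zero    = refl
C2-double (suc n) = begin
  suc (suc n) C 2 + suc (suc n) C 2            ≡⟨ cong (λ x → x + x) (C2-suc (suc n)) ⟩
  suc n + suc n C 2 + (suc n + suc n C 2)      ≡⟨ +-+-swap (suc n) (suc n C 2) ⟩
  suc n + suc n + (suc n C 2 + suc n C 2)      ≡⟨ cong (suc n + suc n +_) (C2-double n) ⟩
  suc n + suc n + suc n * n                    ≡⟨ expand n ⟩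
  suc (suc n) * suc n                          ∎
  where
  open ≡-Reasoning
  +-+-swap : ∀ x y → x + y + (x + y) ≡ x + x + (y + y)
  +-+-swap = solve-∀
  expand : ∀ n → suc n + suc n + suc n * n ≡ suc (suc n) * suc n
  expand = solve-∀

C2-+ : ∀ q k → (q + k) C 2 ≡ q C 2 + k C 2 + q * k
C2-+ zero    k = sym (+-identityʳ (k C 2))
C2-+ (suc q) k = begin
  suc (q + k) C 2                     ≡⟨ C2-suc (q + k) ⟩
  q + k + (q + k) C 2                 ≡⟨ cong (q + k +_) (C2-+ q k) ⟩
  q + k + (q C 2 + k C 2 + q * k)     ≡⟨ rearrange q k (q C 2) (k C 2) ⟩
  q + q C 2 + k C 2 + suc q * k       ≡⟨ cong (λ x → x + k C 2 + suc q * k) (C2-suc q) ⟨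
  suc q C 2 + k C 2 + suc q * k       ∎
  where
  open ≡-Reasoning
  rearrange : ∀ q k x y → q + k + (x + y + q * k) ≡ q + x + y + (k + q * k)
  rearrange = solve-∀

C2-complement : ∀ {r k c} → r + k ≡ suc c → r C 2 + k * c ≡ suc c C 2 + k C 2
C2-complement {r} {zero}  r+0≡ = cong (λ x → x C 2 + 0) (trans (sym (+-identityʳ r)) r+0≡)
C2-complement {r} {suc j} r+k≡ with refl ← suc-injective (trans (sym (+-suc r j)) r+k≡) = begin
  r C 2 + suc j * (r + j)                          ≡⟨ cong (r C 2 +_) (expand r j) ⟩
  r C 2 + (suc j * j + r * suc j)                  ≡⟨ cong (λ x → r C 2 + (x + r * suc j)) (C2-double j) ⟨
  r C 2 + (suc j C 2 + suc j C 2 + r * suc j)      ≡⟨ rearrange (r C 2) (suc j C 2) (r * suc j) ⟩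
  r C 2 + suc j C 2 + r * suc j + suc j C 2        ≡⟨ cong (_+ suc j C 2) (C2-+ r (suc j)) ⟨
  (r + suc j) C 2 + suc j C 2                      ≡⟨ cong (λ x → x C 2 + suc j C 2) (+-suc r j) ⟩
  suc (r + j) C 2 + suc j C 2                      ∎
  where
  open ≡-Reasoning
  expand : ∀ r j → suc j * (r + j) ≡ suc j * j + r * suc j
  expand = solve-∀
  rearrange : ∀ x y z → x + (y + y + z) ≡ x + y + z + y
  rearrange = solve-∀

C2-odd : ∀ m → suc (m + m) C 2 ≡ m + m * (m + m)
C2-odd m = +-double-injective (trans (C2-double (m + m)) (expand m))
  where
  expand : ∀ m → suc (m + m) * (m + m) ≡ m + m * (m + m) + (m + m * (m + m))
  expand = solve-∀

∑< : ℕ → (ℕ → ℕ) → ℕ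
∑< zero    f = 0
∑< (suc k) f = f 0 + ∑< k (λ i → f (suc i))

∑<-cong : ∀ k {f g : ℕ → ℕ} → (∀ i → i < k → f i ≡ g i) → ∑< k f ≡ ∑< k g
∑<-cong zero    f≡g = refl
∑<-cong (suc k) f≡g = cong₂ _+_ (f≡g 0 (s≤s z≤n)) (∑<-cong k λ i i<k → f≡g (suc i) (s≤s i<k))

∑<-zero : ∀ k {f : ℕ → ℕ} → (∀ i → i < k → f i ≡ 0) → ∑< k f ≡ 0
∑<-zero zero    f≡0 = refl
∑<-zero (suc k) f≡0 = cong₂ _+_ (f≡0 0 (s≤s z≤n)) (∑<-zero k λ i i<k → f≡0 (suc i) (s≤s i<k))

∑<-delta : ∀ k {f : ℕ → ℕ} w → w < k → (∀ i → i < k → i ≢ w → f i ≡ 0) → ∑< k f ≡ f w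
∑<-delta (suc k) {f} zero _ f≡0 =
  trans (cong (f 0 +_) (∑<-zero k λ i i<k → f≡0 (suc i) (s≤s i<k) λ ())) (+-identityʳ (f 0))
∑<-delta (suc k) (suc w) (s≤s w<k) f≡0 =
  cong₂ _+_ (f≡0 0 (s≤s z≤n) λ ()) (∑<-delta k w w<k λ i i<k i≢w → f≡0 (suc i) (s≤s i<k) (i≢w ∘ suc-injective))

∑<-suc : ∀ k (f : ℕ → ℕ) → ∑< (suc k) f ≡ ∑< k f + f k
∑<-suc zero    f = +-comm (f 0) 0
∑<-suc (suc k) f = trans (cong (f 0 +_) (∑<-suc k (λ i → f (suc i)))) (sym (+-assoc (f 0) _ (f (suc k))))

∑<-≤ : ∀ k {f : ℕ → ℕ} {E} → (∀ i → i < k → f i ≤ E) → ∑< k f ≤ k * E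
∑<-≤ zero    _   = z≤n
∑<-≤ (suc k) f≤E = +-mono-≤ (f≤E 0 (s≤s z≤n)) (∑<-≤ k λ i i< → f≤E (suc i) (s≤s i<))

sum-applyUpTo : ∀ (f : ℕ → ℕ) k → sum (applyUpTo f k) ≡ ∑< k f
sum-applyUpTo f zero    = refl
sum-applyUpTo f (suc k) = cong (f 0 +_) (sum-applyUpTo (λ i → f (suc i)) k)

∑≡∑< : ∀ a b f → ∑[ a to b ] f ≡ ∑< (suc b ∸ a) (λ j → f (a + j))
∑≡∑< a b f = trans (cong sum (map-upTo (λ j → f (a + j)) (suc b ∸ a))) (sum-applyUpTo (λ j → f (a + j)) (suc b ∸ a))

+-<-∸⇒≤ : ∀ a b {j} → j < suc b ∸ a → a + j ≤ b
+-<-∸⇒≤ zero          b       j<b+1 = ≤-pred j<b+1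
+-<-∸⇒≤ (suc a)       (suc b) j<    = s≤s (+-<-∸⇒≤ a b j<)
+-<-∸⇒≤ (suc zero)    zero    ()
+-<-∸⇒≤ (suc (suc a)) zero    ()

∸-<-∸ : ∀ {a b v} → a ≤ v → v ≤ b → v ∸ a < suc b ∸ a
∸-<-∸ {a} {b} {v} a≤v v≤b = subst (v ∸ a <_) (sym (+-∸-assoc 1 (≤-trans a≤v v≤b))) (s≤s (∸-monoˡ-≤ {v} {b} a v≤b))

∑-cong : ∀ a b {f g} → (∀ j → a ≤ j → j ≤ b → f j ≡ g j) → ∑[ a to b ] f ≡ ∑[ a to b ] g
∑-cong a b {f} {g} f≡g = begin
  ∑[ a to b ] f                           ≡⟨ ∑≡∑< a b f ⟩
  ∑< (suc b ∸ a) (λ j → f (a + j))        ≡⟨ ∑<-cong _ (λ j j< → f≡g (a + j) (m≤m+n a j) (+-<-∸⇒≤ a b j<)) ⟩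
  ∑< (suc b ∸ a) (λ j → g (a + j))        ≡⟨ ∑≡∑< a b g ⟨
  ∑[ a to b ] g                           ∎
  where open ≡-Reasoning

∑-zero : ∀ a b {f} → (∀ j → a ≤ j → j ≤ b → f j ≡ 0) → ∑[ a to b ] f ≡ 0
∑-zero a b {f} f≡0 = trans (∑≡∑< a b f) (∑<-zero _ λ j j< → f≡0 (a + j) (m≤m+n a j) (+-<-∸⇒≤ a b j<))

∑-delta : ∀ a b {f} v → a ≤ v → v ≤ b → (∀ j → j ≢ v → f j ≡ 0) → ∑[ a to b ] f ≡ f v
∑-delta a b {f} v a≤v v≤b f≡0 = begin
  ∑[ a to b ] f                     ≡⟨ ∑≡∑< a b f ⟩
  ∑< (suc b ∸ a) (λ j → f (a + j))  ≡⟨ ∑<-delta _ (v ∸ a) (∸-<-∸ a≤v v≤b) (λ j _ j≢ → f≡0 (a + j) (j≢ ∘ a+j≡v⇒)) ⟩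
  f (a + (v ∸ a))                   ≡⟨ cong f (m+[n∸m]≡n a≤v) ⟩
  f v                               ∎
  where
  open ≡-Reasoning
  a+j≡v⇒ : ∀ {j} → a + j ≡ v → j ≡ v ∸ a
  a+j≡v⇒ {j} refl = sym (m+n∸m≡n a j)

sum-map-+ : ∀ (f g : A → ℕ) xs → sum (map (λ x → f x + g x) xs) ≡ sum (map f xs) + sum (map g xs)
sum-map-+ f g []       = refl
sum-map-+ f g (x ∷ xs) = trans (cong (f x + g x +_) (sum-map-+ f g xs))
                               (+-+-swap (f x) (g x) (sum (map f xs)) (sum (map g xs)))
  where
  +-+-swap : ∀ p q r s → p + q + (r + s) ≡ p + r + (q + s)
  +-+-swap = solve-∀

sum-map-zero : ∀ (xs : List A) → sum (map (λ _ → 0) xs) ≡ 0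
sum-map-zero []       = refl
sum-map-zero (_ ∷ xs) = sum-map-zero xs

sum-map-swap : ∀ (h : A → B → ℕ) xs ys →
               sum (map (λ x → sum (map (h x) ys)) xs) ≡ sum (map (λ y → sum (map (λ x → h x y) xs)) ys)
sum-map-swap h []       ys = sym (sum-map-zero ys)
sum-map-swap h (x ∷ xs) ys = trans (cong (sum (map (h x) ys) +_) (sum-map-swap h xs ys))
                                   (sym (sum-map-+ (h x) _ ys))

-- Lists indexed from zero (the _at_ of Defs is 1-based)

infixl 9 _!_

_!_ : List ℕ → ℕ → ℕ
[]       ! _     = 0
(x ∷ _)  ! zero  = x
(_ ∷ xs) ! suc i = xs ! i

at≡! : ∀ s i → s at suc i ≡ s ! i
at≡! []           i       = refl
at≡! (x ∷ s)      zero    = refl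
at≡! (x ∷ [])     (suc i) = refl
at≡! (x ∷ y ∷ s)  (suc i) = at≡! (y ∷ s) i

!-ext : ∀ {xs ys} → length xs ≡ length ys → (∀ i → i < length xs → xs ! i ≡ ys ! i) → xs ≡ ys
!-ext {[]}     {[]}     _   _     = refl
!-ext {x ∷ xs} {y ∷ ys} len x!≡y! =
  cong₂ _∷_ (x!≡y! 0 (s≤s z≤n)) (!-ext (suc-injective len) λ i i< → x!≡y! (suc i) (s≤s i<))

take-! : ∀ k xs {i} → i < k → take k xs ! i ≡ xs ! i
take-! (suc k) []       _         = refl
take-! (suc k) (x ∷ xs) {zero}  _ = refl
take-! (suc k) (x ∷ xs) {suc i} (s≤s i<k) = take-! k xs i<k

applyUpTo-! : ∀ (f : ℕ → ℕ) n {i} → i < n → applyUpTo f n ! i ≡ f i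
applyUpTo-! f (suc n) {zero}  _         = refl
applyUpTo-! f (suc n) {suc i} (s≤s i<n) = applyUpTo-! (λ j → f (suc j)) n i<n

take-applyUpTo : ∀ (f : ℕ → ℕ) {k n} → k ≤ n → take k (applyUpTo f n) ≡ applyUpTo f k
take-applyUpTo f {zero}  _         = refl
take-applyUpTo f {suc k} (s≤s k≤n) = cong (f 0 ∷_) (take-applyUpTo (λ i → f (suc i)) k≤n)

psum≡∑< : ∀ r s → psum r s ≡ ∑< r (s !_)
psum≡∑< zero    s        = refl
psum≡∑< (suc r) []       = sym (∑<-zero (suc r) λ _ _ → refl)
psum≡∑< (suc r) (x ∷ xs) = cong (x +_) (psum≡∑< r xs)

sum≡∑< : ∀ s → sum s ≡ ∑< (length s) (s !_)
sum≡∑< []      = refl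
sum≡∑< (x ∷ s) = cong (x +_) (sum≡∑< s)

!-mono : ∀ {s} → NonDecreasing s → ∀ {i j} → i ≤ j → j < length s → s ! i ≤ s ! j
!-mono [-]        z≤n       (s≤s z≤n)  = ≤-refl
!-mono (_ ∷ _)    {zero} {zero} _ _    = ≤-refl
!-mono (x≤y ∷ xs↑) {zero} {suc j} _ (s≤s j<) = ≤-trans x≤y (!-mono xs↑ z≤n j<)
!-mono (_ ∷ xs↑)  (s≤s i≤j) (s≤s j<)   = !-mono xs↑ i≤j j<

!≤last : ∀ {s ℓ} → NonDecreasing s → length s ≡ suc ℓ → ∀ i → i < suc ℓ → s ! i ≤ s at suc ℓ
!≤last {s} {ℓ} s↑ len i i<ℓ+1 =
  subst (s ! i ≤_) (sym (at≡! s ℓ)) (!-mono s↑ (≤-pred i<ℓ+1) (subst (ℓ <_) (sym len) ≤-refl))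

All-! : ∀ {P : ℕ → Set} s → (∀ i → i < length s → P (s ! i)) → All P s
All-! []      _ = []
All-! (x ∷ s) p = p 0 (s≤s z≤n) ∷ All-! s λ i i< → p (suc i) (s≤s i<)

All≤sum : ∀ s → All (_≤ sum s) s
All≤sum []      = []
All≤sum (x ∷ s) = m≤m+n x (sum s) ∷ All.map (λ y≤ → ≤-trans y≤ (m≤n+m (sum s) x)) (All≤sum s)

𝟙 : {P : Set} → Dec P → ℕ
𝟙 (yes _) = 1
𝟙 (no _)  = 0

𝟙-yes : {P : Set} (P? : Dec P) → P → 𝟙 P? ≡ 1
𝟙-yes (yes _) _ = refl
𝟙-yes (no ¬p) p = contradiction p ¬p

𝟙-no : {P : Set} (P? : Dec P) → ¬ P → 𝟙 P? ≡ 0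
𝟙-no (yes p) ¬p = contradiction p ¬p
𝟙-no (no _)  _  = refl

length-filter≡sum-𝟙 : ∀ {P : A → Set} (P? : Decidable P) xs → length (filter P? xs) ≡ sum (map (λ x → 𝟙 (P? x)) xs)
length-filter≡sum-𝟙 P? []       = refl
length-filter≡sum-𝟙 P? (x ∷ xs) with P? x
... | yes _ = cong suc (length-filter≡sum-𝟙 P? xs)
... | no _  = length-filter≡sum-𝟙 P? xs

unique-injection⇒length≤ : ∀ (f : A → B) {xs ys} → Unique xs →
  (∀ {x y} → x ∈ xs → y ∈ xs → f x ≡ f y → x ≡ y) → (∀ {x} → x ∈ xs → f x ∈ ys) → length xs ≤ length ys
unique-injection⇒length≤ f {[]}     _           _   _    = z≤n
unique-injection⇒length≤ f {x ∷ xs} (x∉xs ∷ xs!) inj into with ys₁ , ys₂ , refl ← ∈-∃++ (into (here refl)) = begin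
  suc (length xs)                  ≤⟨ s≤s (unique-injection⇒length≤ f xs! (λ p q → inj (there p) (there q)) into′) ⟩
  suc (length (ys₁ ++ ys₂))        ≡⟨ cong suc (length-++ ys₁) ⟩
  suc (length ys₁ + length ys₂)    ≡⟨ +-suc (length ys₁) (length ys₂) ⟨
  length ys₁ + length (f x ∷ ys₂)  ≡⟨ length-++ ys₁ ⟨
  length (ys₁ ++ f x ∷ ys₂)        ∎
  where
  open ≤-Reasoning
  into′ : ∀ {z} → z ∈ xs → f z ∈ ys₁ ++ ys₂
  into′ {z} z∈xs with ∈-++⁻ ys₁ (into (there z∈xs))
  ... | inj₁ p         = ∈-++⁺ˡ p
  ... | inj₂ (there p) = ∈-++⁺ʳ ys₁ p
  ... | inj₂ (here fz≡fx) with refl ← inj (there z∈xs) (here refl) fz≡fx = ⊥-elim (All¬⇒¬Any x∉xs z∈xs)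

module _ {P : A → Set} {Q : B → Set} (P? : Decidable P) (Q? : Decidable Q) where

  length-filter-≤-by-retraction : ∀ {xs ys} (f : A → B) (g : B → A) → Unique xs →
    (∀ {x} → x ∈ xs → P x → f x ∈ ys × Q (f x) × g (f x) ≡ x) →
    length (filter P? xs) ≤ length (filter Q? ys)
  length-filter-≤-by-retraction {xs} {ys} f g xs! forth = unique-injection⇒length≤ f (Unique.filter⁺ P? xs!) injective into
    where
    g∘f≡id : ∀ {x} → x ∈ filter P? xs → g (f x) ≡ x
    g∘f≡id x∈ with x∈xs , Px ← ∈-filter⁻ P? x∈ = proj₂ (proj₂ (forth x∈xs Px))
    injective : ∀ {x y} → x ∈ filter P? xs → y ∈ filter P? xs → f x ≡ f y → x ≡ y
    injective x∈ y∈ fx≡fy = trans (sym (g∘f≡id x∈)) (trans (cong g fx≡fy) (g∘f≡id y∈))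
    into : ∀ {x} → x ∈ filter P? xs → f x ∈ filter Q? ys
    into x∈ with x∈xs , Px ← ∈-filter⁻ P? x∈ with fx∈ys , Qfx , _ ← forth x∈xs Px = ∈-filter⁺ Q? fx∈ys Qfx

length-filter-≡-by-inverses : ∀ {P : A → Set} {Q : B → Set} (P? : Decidable P) (Q? : Decidable Q) {xs ys}
  (f : A → B) (g : B → A) → Unique xs → Unique ys →
  (∀ {x} → x ∈ xs → P x → f x ∈ ys × Q (f x) × g (f x) ≡ x) →
  (∀ {y} → y ∈ ys → Q y → g y ∈ xs × P (g y) × f (g y) ≡ y) →
  length (filter P? xs) ≡ length (filter Q? ys)
length-filter-≡-by-inverses P? Q? f g xs! ys! forth back =
  ≤-antisym (length-filter-≤-by-retraction P? Q? f g xs! forth) (length-filter-≤-by-retraction Q? P? g f ys! back)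

∑-length-filter : ∀ {P : ℕ → A → Set} (P? : ∀ j → Decidable (P j)) (key : A → ℕ) →
  (∀ {j x} → P j x → j ≡ key x) → ∀ a b xs →
  ∑[ a to b ] (λ j → length (filter (P? j) xs))
    ≡ length (filter (λ x → ((a ≤? key x) ×-dec (key x ≤? b)) ×-dec P? (key x) x) xs)
∑-length-filter {P = P} P? key j≡key a b xs = begin
  ∑[ a to b ] (λ j → length (filter (P? j) xs))    ≡⟨ ∑-cong a b (λ j _ _ → length-filter≡sum-𝟙 (P? j) xs) ⟩
  ∑[ a to b ] (λ j → sum (map (λ x → 𝟙 (P? j x)) xs))
    ≡⟨ sum-map-swap (λ j x → 𝟙 (P? (a + j) x)) (upTo (suc b ∸ a)) xs ⟩
  sum (map (λ x → ∑[ a to b ] (λ j → 𝟙 (P? j x))) xs)  ≡⟨ cong sum (map-cong ∑𝟙≡𝟙 xs) ⟩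
  sum (map (λ x → 𝟙 (Q? x)) xs)                        ≡⟨ length-filter≡sum-𝟙 Q? xs ⟨
  length (filter Q? xs)                                ∎
  where
  open ≡-Reasoning
  Q? = λ x → ((a ≤? key x) ×-dec (key x ≤? b)) ×-dec P? (key x) x
  ∑𝟙≡𝟙 : ∀ x → ∑[ a to b ] (λ j → 𝟙 (P? j x)) ≡ 𝟙 (Q? x)
  ∑𝟙≡𝟙 x with Q? x
  ... | yes ((a≤ , ≤b) , Pkx) = trans (∑-delta a b (key x) a≤ ≤b λ j j≢ → 𝟙-no (P? j x) (j≢ ∘ j≡key))
                                      (𝟙-yes (P? (key x) x) Pkx)
  ... | no ¬Q = ∑-zero a b λ j a≤j j≤b → 𝟙-no (P? j x) λ Pjx → ¬Q (subst (λ k → (a ≤ k × k ≤ b) × P k x) (j≡key Pjx) ((a≤j , j≤b) , Pjx))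

concatMap-map≡cartesianProductWith : ∀ {C : Set} (f : A → B → C) xs ys →
  concatMap (λ x → map (f x) ys) xs ≡ cartesianProductWith f xs ys
concatMap-map≡cartesianProductWith f []       ys = refl
concatMap-map≡cartesianProductWith f (x ∷ xs) ys = cong (map (f x) ys ++_) (concatMap-map≡cartesianProductWith f xs ys)

lists≤-suc : ∀ B n → lists≤ B (suc n) ≡ cartesianProductWith _∷_ (upTo (suc B)) (lists≤ B n)
lists≤-suc B n = concatMap-map≡cartesianProductWith _∷_ (upTo (suc B)) (lists≤ B n)

lists≤-unique : ∀ B n → Unique (lists≤ B n)
lists≤-unique B zero    = [] ∷ []
lists≤-unique B (suc n) = subst Unique (sym (lists≤-suc B n))
  (Unique.cartesianProductWith⁺ _∷_ ∷-injective (Unique.upTo⁺ (suc B)) (lists≤-unique B n))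

∈-lists≤⁺ : ∀ B {s} → All (_≤ B) s → s ∈ lists≤ B (length s)
∈-lists≤⁺ B []       = here refl
∈-lists≤⁺ B {x ∷ s} (x≤B ∷ s≤B) =
  subst (x ∷ s ∈_) (sym (lists≤-suc B (length s))) (∈-cartesianProductWith⁺ _∷_ (∈-upTo⁺ (s≤s x≤B)) (∈-lists≤⁺ B s≤B))

∈-lists≤⁻ : ∀ B n {s} → s ∈ lists≤ B n → length s ≡ n × All (_≤ B) s
∈-lists≤⁻ B zero    (here refl) = refl , []
∈-lists≤⁻ B (suc n) s∈
  with x , s′ , x∈ , s′∈ , refl ← ∈-cartesianProductWith⁻ _∷_ (upTo (suc B)) (lists≤ B n) (subst (_ ∈_) (lists≤-suc B n) s∈)
  with len , s′≤B ← ∈-lists≤⁻ B n s′∈ = cong suc len , ≤-pred (∈-upTo⁻ x∈) ∷ s′≤B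

length-filter-lists≤-bound : ∀ {P : List ℕ → Set} (P? : Decidable P) B B′ n →
  (∀ {s} → P s → All (_≤ B) s) → (∀ {s} → P s → All (_≤ B′) s) →
  length (filter P? (lists≤ B n)) ≡ length (filter P? (lists≤ B′ n))
length-filter-lists≤-bound {P} P? B B′ n ≤B ≤B′ =
  length-filter-≡-by-inverses P? P? id id (lists≤-unique B n) (lists≤-unique B′ n) (rebound B′ ≤B′) (rebound B ≤B)
  where
  rebound : ∀ {B₀} B₁ → (∀ {s} → P s → All (_≤ B₁) s) → ∀ {s} → s ∈ lists≤ B₀ n → P s → s ∈ lists≤ B₁ n × P s × s ≡ s
  rebound {B₀} B₁ ≤B₁ {s} s∈ Ps = subst (λ l → s ∈ lists≤ B₁ l) (proj₁ (∈-lists≤⁻ B₀ n s∈)) (∈-lists≤⁺ B₁ (≤B₁ Ps)) , Ps , refl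

scoreSeq∈lists≤ : ∀ {n t} → ScoreSeq n t → t ∈ lists≤ (n C 2) n
scoreSeq∈lists≤ {n} {t} (len , _ , _ , sum≡) =
  subst (λ l → t ∈ lists≤ (n C 2) l) len (∈-lists≤⁺ (n C 2) (subst (λ x → All (_≤ x) t) sum≡ (All≤sum t)))

Complementary : ℕ → (ℕ → ℕ) → Set
Complementary c a = ∀ i j → i + j ≡ c → a i + a j ≡ c

complementary⇒paired : ∀ {c a} → Complementary c a → ∀ i → i ≤ c → a i + a (c ∸ i) ≡ c
complementary⇒paired a-comp i i≤c = a-comp i _ (m+[n∸m]≡n i≤c)

complementary⇒≤ : ∀ {c a} → Complementary c a → ∀ i → i ≤ c → a i ≤ c
complementary⇒≤ {c} {a} a-comp i i≤c = subst (a i ≤_) (complementary⇒paired {a = a} a-comp i i≤c) (m≤m+n (a i) _)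

∑<-complement : ∀ c (a : ℕ → ℕ) k → k ≤ suc c → (∀ i → i < k → a i + a (c ∸ i) ≡ c) →
                ∑< (suc c ∸ k) a + k * c ≡ ∑< (suc c) a + ∑< k a
∑<-complement c a zero    _     _        = refl
∑<-complement c a (suc k) k<c+1 paired = begin
  ∑< (c ∸ k) a + (c + k * c)                       ≡⟨ cong (λ x → ∑< (c ∸ k) a + (x + k * c)) (paired k ≤-refl) ⟨
  ∑< (c ∸ k) a + (a k + a (c ∸ k) + k * c)         ≡⟨ rearrange (∑< (c ∸ k) a) (a k) (a (c ∸ k)) (k * c) ⟩
  ∑< (c ∸ k) a + a (c ∸ k) + k * c + a k           ≡⟨ cong (λ x → x + k * c + a k) (∑<-suc (c ∸ k) a) ⟨
  ∑< (suc (c ∸ k)) a + k * c + a k                 ≡⟨ cong (λ x → ∑< x a + k * c + a k) (+-∸-assoc 1 (≤-pred k<c+1)) ⟨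
  ∑< (suc c ∸ k) a + k * c + a k                   ≡⟨ cong (_+ a k) (∑<-complement c a k (<⇒≤ k<c+1) λ i i<k → paired i (m<n⇒m<1+n i<k)) ⟩
  ∑< (suc c) a + ∑< k a + a k                      ≡⟨ +-assoc (∑< (suc c) a) (∑< k a) (a k) ⟩
  ∑< (suc c) a + (∑< k a + a k)                    ≡⟨ cong (∑< (suc c) a +_) (∑<-suc k a) ⟨
  ∑< (suc c) a + ∑< (suc k) a                      ∎
  where
  open ≡-Reasoning
  rearrange : ∀ x y z w → x + (y + z + w) ≡ x + z + w + y
  rearrange = solve-∀

∑<-complementary : ∀ c {a} → Complementary c a → ∑< (suc c) a ≡ suc c C 2
∑<-complementary c {a} a-comp = +-double-injective (begin
  ∑< (suc c) a + ∑< (suc c) a                ≡⟨ ∑<-complement c a (suc c) ≤-refl (λ i i< → complementary⇒paired {a = a} a-comp i (≤-pred i<)) ⟨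
  ∑< (suc c ∸ suc c) a + suc c * c           ≡⟨ cong (λ x → ∑< x a + suc c * c) (n∸n≡0 c) ⟩
  suc c * c                                  ≡⟨ C2-double c ⟨
  suc c C 2 + suc c C 2                      ∎)
  where open ≡-Reasoning

-- m = k + 1 and e ∈ {m - 1, m}, so that n = m + e + 1 is 2m or 2m + 1 and c = n - 1.
module HalfSequences (k e : ℕ) (k≤e : k ≤ e) (e≤m : e ≤ suc k) where

  m c n : ℕ
  m = suc k
  c = m + e
  n = suc c

  m<n : m < n
  m<n = s≤s (m≤m+n m e)

  i<m⇒i≤c : ∀ {i} → i < m → i ≤ c
  i<m⇒i≤c i<m = ≤-trans (<⇒≤ i<m) (m≤m+n m e)

  n∸m≡1+e : n ∸ m ≡ suc e
  n∸m≡1+e = trans (cong (_∸ k) (sym (+-suc k e))) (m+n∸m≡n k (suc e))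

  data Region (i : ℕ) : Set where
    left   : i < m → Region i
    centre : m ≤ i → i ≤ e → Region i
    right  : e < i → Region i

  region : ∀ i → Region i
  region i with i <? m | e <? i
  ... | yes i<m | _       = left i<m
  ... | no  i≮m | no e≮i  = centre (≮⇒≥ i≮m) (≮⇒≥ e≮i)
  ... | no  _   | yes e<i = right e<i

  left⇒≤e : ∀ {i} → i < m → i ≤ e
  left⇒≤e i<m = ≤-trans (≤-pred i<m) k≤e

  centre⇒e≡m : ∀ {i} → m ≤ i → i ≤ e → e ≡ m
  centre⇒e≡m m≤i i≤e = ≤-antisym e≤m (≤-trans m≤i i≤e)

  centre⇒≡m : ∀ {i} → m ≤ i → i ≤ e → i ≡ m
  centre⇒≡m m≤i i≤e = ≤-antisym (≤-trans i≤e e≤m) m≤i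

  centre-mirror : ∀ {i j} → i + j ≡ c → m ≤ i → i ≤ e → m ≤ j × j ≤ e
  centre-mirror {i} {j} i+j≡c m≤i i≤e = ≤-trans m≤i (≤-trans i≤e (≤-reflexive (sym j≡e))) , ≤-reflexive j≡e
    where
    j≡e : j ≡ e
    j≡e = +-cancelˡ-≡ m j e (trans (cong (_+ j) (sym (centre⇒≡m m≤i i≤e))) i+j≡c)

  ∸-mirror : ∀ {i j} → i + j ≡ c → c ∸ j ≡ i
  ∸-mirror {i} {j} i+j≡c = trans (cong (_∸ j) (sym i+j≡c)) (m+n∸n≡m i j)

  left-mirror : ∀ {i j} → i + j ≡ c → i < m → e < j
  left-mirror {i} {j} i+j≡c (s≤s i≤k) = +-cancelˡ-≤ k (suc e) j (begin
    k + suc e  ≡⟨ +-suc k e ⟩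
    m + e      ≡⟨ i+j≡c ⟨
    i + j      ≤⟨ +-monoˡ-≤ j i≤k ⟩
    k + j      ∎)
    where open ≤-Reasoning

  right-mirror : ∀ {i j} → i + j ≡ c → e < i → j < m
  right-mirror {i} {j} i+j≡c e<i = +-cancelʳ-≤ e (suc j) m (begin
    suc j + e  ≡⟨ cong suc (+-comm j e) ⟩
    suc e + j  ≤⟨ +-monoˡ-≤ j e<i ⟩
    i + j      ≡⟨ i+j≡c ⟩
    m + e      ∎)
    where open ≤-Reasoning

  -- The self-complementary completion of the first half s; the centre is non-empty only for odd n.
  extend : List ℕ → ℕ → ℕ
  extend s i with region i
  ... | left _     = s ! i
  ... | centre _ _ = m
  ... | right _    = c ∸ s ! (c ∸ i)

  extend-left : ∀ s {i} → i < m → extend s i ≡ s ! i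
  extend-left s {i} i<m with region i
  ... | left _         = refl
  ... | centre m≤i _   = contradiction i<m (≤⇒≯ m≤i)
  ... | right e<i      = contradiction e<i (≤⇒≯ (left⇒≤e i<m))

  extend-centre : ∀ s {i} → m ≤ i → i ≤ e → extend s i ≡ m
  extend-centre s {i} m≤i i≤e with region i
  ... | left i<m       = contradiction i<m (≤⇒≯ m≤i)
  ... | centre _ _     = refl
  ... | right e<i      = contradiction e<i (≤⇒≯ i≤e)

  extend-right : ∀ s {i} → e < i → extend s i ≡ c ∸ s ! (c ∸ i)
  extend-right s {i} e<i with region i
  ... | left i<m       = contradiction e<i (≤⇒≯ (left⇒≤e i<m))
  ... | centre _ i≤e   = contradiction e<i (≤⇒≯ i≤e)
  ... | right _        = refl

  extend-complementary : ∀ {s} → (∀ i → i < m → s ! i ≤ c) → Complementary c (extend s)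
  extend-complementary {s} s≤c i j i+j≡c = by-region (region i)
    where
    by-region : Region i → extend s i + extend s j ≡ c
    by-region (left i<m) = begin
      extend s i + extend s j          ≡⟨ cong₂ _+_ (extend-left s i<m) (extend-right s (left-mirror i+j≡c i<m)) ⟩
      s ! i + (c ∸ s ! (c ∸ j))        ≡⟨ cong (λ x → s ! i + (c ∸ s ! x)) (∸-mirror i+j≡c) ⟩
      s ! i + (c ∸ s ! i)              ≡⟨ m+[n∸m]≡n (s≤c i i<m) ⟩
      c                                ∎
      where open ≡-Reasoning
    by-region (right e<i) = begin
      extend s i + extend s j          ≡⟨ cong₂ _+_ (extend-right s e<i) (extend-left s j<m) ⟩
      (c ∸ s ! (c ∸ i)) + s ! j        ≡⟨ cong (λ x → (c ∸ s ! x) + s ! j) (∸-mirror (trans (+-comm j i) i+j≡c)) ⟩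
      (c ∸ s ! j) + s ! j              ≡⟨ m∸n+n≡m (s≤c j j<m) ⟩
      c                                ∎
      where
      open ≡-Reasoning
      j<m = right-mirror i+j≡c e<i
    by-region (centre m≤i i≤e) = begin
      extend s i + extend s j          ≡⟨ cong₂ _+_ (extend-centre s m≤i i≤e) (extend-centre s m≤j j≤e) ⟩
      m + m                            ≡⟨ cong (m +_) (centre⇒e≡m m≤i i≤e) ⟨
      c                                ∎
      where
      open ≡-Reasoning
      m≤j = proj₁ (centre-mirror i+j≡c m≤i i≤e)
      j≤e = proj₂ (centre-mirror i+j≡c m≤i i≤e)

  module _ {s} (s↑ : NonDecreasing s) (len : length s ≡ m) (s≤e : ∀ i → i < m → s ! i ≤ e) where

    extend≤m : ∀ {i} → i ≤ e → extend s i ≤ m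
    extend≤m {i} i≤e with region i
    ... | left i<m   = ≤-trans (s≤e i i<m) e≤m
    ... | centre _ _ = ≤-refl
    ... | right e<i  = contradiction e<i (≤⇒≯ i≤e)

    m≤extend : ∀ {i} → m ≤ i → i ≤ c → m ≤ extend s i
    m≤extend {i} m≤i i≤c with region i
    ... | left i<m   = contradiction i<m (≤⇒≯ m≤i)
    ... | centre _ _ = ≤-refl
    ... | right e<i  = m+n≤o⇒m≤o∸n m (+-monoʳ-≤ m (s≤e (c ∸ i) (right-mirror (m+[n∸m]≡n i≤c) e<i)))

    extend-step : ∀ i → suc i ≤ c → extend s i ≤ extend s (suc i)
    extend-step i 1+i≤c = by-cases (suc i <? m) (e <? i)
      where
      by-cases : Dec (suc i < m) → Dec (e < i) → extend s i ≤ extend s (suc i)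
      by-cases (yes 1+i<m) _ = begin
        extend s i        ≡⟨ extend-left s (<-trans (n<1+n i) 1+i<m) ⟩
        s ! i             ≤⟨ !-mono s↑ (n≤1+n i) (subst (suc i <_) (sym len) 1+i<m) ⟩
        s ! suc i         ≡⟨ extend-left s 1+i<m ⟨
        extend s (suc i)  ∎
        where open ≤-Reasoning
      by-cases (no _) (yes e<i) = begin
        extend s i                  ≡⟨ extend-right s e<i ⟩
        c ∸ s ! (c ∸ i)             ≤⟨ ∸-monoʳ-≤ c (!-mono s↑ (∸-monoʳ-≤ c (n≤1+n i)) c∸i<len) ⟩
        c ∸ s ! (c ∸ suc i)         ≡⟨ extend-right s (m<n⇒m<1+n e<i) ⟨
        extend s (suc i)            ∎
        where
        open ≤-Reasoning
        c∸i<len = subst (c ∸ i <_) (sym len) (right-mirror (m+[n∸m]≡n (≤-trans (n≤1+n i) 1+i≤c)) e<i)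
      by-cases (no 1+i≮m) (no e≮i) = ≤-trans (extend≤m (≮⇒≥ e≮i)) (m≤extend (≮⇒≥ 1+i≮m) 1+i≤c)

  extendList : List ℕ → List ℕ
  extendList s = applyUpTo (extend s) n

  extendList-! : ∀ s {i} → i < n → extendList s ! i ≡ extend s i
  extendList-! s = applyUpTo-! (extend s) n

  take-extendList : ∀ {s} → length s ≡ m → take m (extendList s) ≡ s
  take-extendList {s} len = begin
    take m (extendList s)    ≡⟨ take-applyUpTo (extend s) (<⇒≤ m<n) ⟩
    applyUpTo (extend s) m   ≡⟨ !-ext (trans (length-applyUpTo (extend s) m) (sym len)) entries ⟩
    s                        ∎
    where
    open ≡-Reasoning
    entries : ∀ i → i < length (applyUpTo (extend s) m) → applyUpTo (extend s) m ! i ≡ s ! i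
    entries i i<m′ with i<m ← subst (i <_) (length-applyUpTo (extend s) m) i<m′ =
      trans (applyUpTo-! (extend s) m i<m) (extend-left s i<m)

  strong-extension : ∀ {a} → Complementary c a → (∀ r → 1 ≤ r → r ≤ m → r C 2 < ∑< r a) →
                     ∀ r → 1 ≤ r → r < n → r C 2 < ∑< r a
  strong-extension {a} a-comp strong-to-m r 1≤r r<n with r ≤? m
  ... | yes r≤m = strong-to-m r 1≤r r≤m
  ... | no  r≰m = +-cancelʳ-< (r′ * c) (r C 2) (∑< r a) (begin-strict
    r C 2 + r′ * c          ≡⟨ C2-complement {r} {r′} (m+[n∸m]≡n (<⇒≤ r<n)) ⟩
    n C 2 + r′ C 2          <⟨ +-monoʳ-< (n C 2) (strong-to-m r′ (m<n⇒0<n∸m r<n) r′≤m) ⟩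
    n C 2 + ∑< r′ a         ≡⟨ cong (_+ ∑< r′ a) (∑<-complementary c {a} a-comp) ⟨
    ∑< n a + ∑< r′ a        ≡⟨ ∑<-complement c a r′ (m∸n≤m n r) paired ⟨
    ∑< (n ∸ r′) a + r′ * c  ≡⟨ cong (λ x → ∑< x a + r′ * c) (m∸[m∸n]≡n (<⇒≤ r<n)) ⟩
    ∑< r a + r′ * c         ∎)
    where
    open ≤-Reasoning
    r′ = n ∸ r
    r′≤m : r′ ≤ m
    r′≤m = ≤-trans (∸-monoʳ-≤ n (≰⇒> r≰m)) (≤-trans (≤-reflexive (m+n∸m≡n m e)) e≤m)
    paired : ∀ i → i < r′ → a i + a (c ∸ i) ≡ c
    paired i i<r′ = complementary⇒paired {a = a} a-comp i (≤-pred (≤-trans i<r′ (m∸n≤m n r)))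

  n/2≡m : n / 2 ≡ m
  n/2≡m = /-between 2 (≤-trans (≤-reflexive (double k)) (s≤s (+-monoʳ-≤ m k≤e)))
                      (≤-trans (s≤s (s≤s (+-monoʳ-≤ m e≤m))) (≤-reflexive (sym (double m))))
    where
    double : ∀ k → suc k * 2 ≡ suc (suc k + k)
    double = solve-∀

  at-mirror : ∀ t {i} → i ≤ c → t at (n + 1 ∸ suc i) ≡ t ! (c ∸ i)
  at-mirror t {i} i≤c = trans (cong (t at_) (trans (+-∸-comm 1 i≤c) (+-comm (c ∸ i) 1))) (at≡! t (c ∸ i))

  selfComp⇒paired : ∀ {t} → SelfComp n t → ∀ i → i < m → t ! i + t ! (c ∸ i) ≡ c
  selfComp⇒paired {t} t-sc i i<m = begin
    t ! i + t ! (c ∸ i)                   ≡⟨ +-comm (t ! i) (t ! (c ∸ i)) ⟩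
    t ! (c ∸ i) + t ! i                   ≡⟨ cong₂ _+_ (at-mirror t (i<m⇒i≤c i<m)) (at≡! t i) ⟨
    t at (n + 1 ∸ suc i) + t at suc i     ≡⟨ t-sc (suc i) (s≤s z≤n) (s≤s (subst (i <_) (sym n/2≡m) i<m)) ⟩
    c                                     ∎
    where open ≡-Reasoning

  complementary⇒selfComp : ∀ {t} → Complementary c (t !_) → SelfComp n t
  complementary⇒selfComp {t} t-comp (suc i) _ (s≤s i<n/2) = begin
    t at (n + 1 ∸ suc i) + t at suc i     ≡⟨ cong₂ _+_ (at-mirror t i≤c) (at≡! t i) ⟩
    t ! (c ∸ i) + t ! i                   ≡⟨ t-comp (c ∸ i) i (m∸n+n≡m i≤c) ⟩
    c                                     ∎
    where
    open ≡-Reasoning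
    i≤c = i<m⇒i≤c (subst (i <_) n/2≡m i<n/2)

  -- Shaped like the predicate ∑-length-filter extracts from the double sum, so that the two
  -- counts meet definitionally.
  HalfSeq : List ℕ → Set
  HalfSeq s = (m C 2 + 1 ≤ sum s × sum s ≤ m * e)
            × (⌈ sum s / m ⌉ ≤ s at m × s at m ≤ e) × GCond m (sum s) (s at m) s

  halfSeq? : Decidable HalfSeq
  halfSeq? s = ((m C 2 + 1 ≤? sum s) ×-dec (sum s ≤? m * e))
             ×-dec (((⌈ sum s / m ⌉ ≤? s at m) ×-dec (s at m ≤? e)) ×-dec gCond? m (sum s) (s at m) s)

  SSCSeq : List ℕ → Set
  SSCSeq t = ScoreSeq n t × (Strong n t × SelfComp n t)

  sscSeq? : Decidable SSCSeq
  sscSeq? t = scoreSeq? n t ×-dec (strong? n t ×-dec selfComp? n t)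

  extendList-SSCSeq : ∀ {s} → HalfSeq s → SSCSeq (extendList s)
  extendList-SSCSeq {s} ((1+mC2≤T , _) , (_ , last≤e) , (len , s↑ , s-strong , _ , _)) =
    (length-t , t↑ , (λ r 1≤r r<n → <⇒≤ (t-strong r 1≤r r<n)) , sum-t) , t-strong , complementary⇒selfComp {t} t-comp
    where
    t = extendList s
    s≤e : ∀ i → i < m → s ! i ≤ e
    s≤e i i<m = ≤-trans (!≤last s↑ len i i<m) last≤e
    length-t : length t ≡ n
    length-t = length-applyUpTo (extend s) n
    t↑ : NonDecreasing t
    t↑ = applyUpTo⁺₁ (extend s) n (λ {i} 1+i<n → extend-step s↑ len s≤e i (≤-pred 1+i<n))
    t! : ∀ {i} → i ≤ c → t ! i ≡ extend s i
    t! i≤c = extendList-! s (s≤s i≤c)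
    t-comp : Complementary c (t !_)
    t-comp i j i+j≡c = trans (cong₂ _+_ (t! (subst (i ≤_) i+j≡c (m≤m+n i j))) (t! (subst (j ≤_) i+j≡c (m≤n+m j i))))
                             (extend-complementary (λ i i<m → ≤-trans (s≤e i i<m) (m≤n+m e m)) i j i+j≡c)
    psum-s : ∀ {r} → r ≤ m → psum r s ≡ ∑< r (t !_)
    psum-s {r} r≤m = trans (psum≡∑< r s) (∑<-cong r λ i i<r →
      sym (trans (t! (i<m⇒i≤c (≤-trans i<r r≤m))) (extend-left s (≤-trans i<r r≤m))))
    strong-to-m : ∀ r → 1 ≤ r → r ≤ m → r C 2 < ∑< r (t !_)
    strong-to-m r 1≤r r≤m with m≤n⇒m<n∨m≡n r≤m
    ... | inj₁ r<m  = subst (r C 2 <_) (psum-s r≤m) (s-strong r 1≤r r<m)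
    ... | inj₂ refl = subst (r C 2 <_) (trans (cong sum (sym (take-all m s (≤-reflexive len)))) (psum-s r≤m))
                            (subst (_≤ sum s) (+-comm (m C 2) 1) 1+mC2≤T)
    t-strong : Strong n t
    t-strong r 1≤r r<n = subst (r C 2 <_) (sym (psum≡∑< r t)) (strong-extension t-comp strong-to-m r 1≤r r<n)
    sum-t : sum t ≡ n C 2
    sum-t = trans (sum≡∑< t) (trans (cong (λ l → ∑< l (t !_)) length-t) (∑<-complementary c {t !_} t-comp))

  module FirstHalf {t} (t-sscs : SSCSeq t) where

    private
      a = t !_
      len-t = proj₁ (proj₁ t-sscs)
      t↑ = proj₁ (proj₂ (proj₁ t-sscs))
      sum-t = proj₂ (proj₂ (proj₂ (proj₁ t-sscs)))
      t-strong = proj₁ (proj₂ t-sscs)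

    s : List ℕ
    s = take m t

    paired : ∀ i → i < m → a i + a (c ∸ i) ≡ c
    paired = selfComp⇒paired {t} (proj₂ (proj₂ t-sscs))

    ∑<-t : ∑< n a ≡ n C 2
    ∑<-t = trans (cong (λ l → ∑< l a) (sym len-t)) (trans (sym (sum≡∑< t)) sum-t)

    -- SelfComp does not constrain the middle entry of an odd sequence; the total C(n,2) does.
    middle : e ≡ m → a m ≡ m
    middle e≡m = +-cancelʳ-≡ (m * c) (a m) m (+-cancelˡ-≡ (∑< m a) _ _ (begin
      ∑< m a + (a m + m * c)   ≡⟨ +-assoc (∑< m a) (a m) (m * c) ⟨
      ∑< m a + a m + m * c     ≡⟨ cong (_+ m * c) (∑<-suc m a) ⟨
      ∑< (suc m) a + m * c     ≡⟨ cong (λ x → ∑< (suc x) a + m * c) e≡m ⟨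
      ∑< (suc e) a + m * c     ≡⟨ cong (λ x → ∑< x a + m * c) n∸m≡1+e ⟨
      ∑< (n ∸ m) a + m * c     ≡⟨ ∑<-complement c a m (<⇒≤ m<n) paired ⟩
      ∑< n a + ∑< m a          ≡⟨ +-comm (∑< n a) (∑< m a) ⟩
      ∑< m a + ∑< n a          ≡⟨ cong (∑< m a +_) (trans ∑<-t nC2≡) ⟩
      ∑< m a + (m + m * c)     ∎))
      where
      open ≡-Reasoning
      nC2≡ : n C 2 ≡ m + m * c
      nC2≡ = subst (λ x → suc (m + x) C 2 ≡ m + m * (m + x)) (sym e≡m) (C2-odd m)

    t-comp : Complementary c a
    t-comp i j i+j≡c with region i
    ... | left i<m  = subst (λ x → a i + a x ≡ c) (∸-mirror (trans (+-comm j i) i+j≡c)) (paired i i<m)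
    ... | right e<i = trans (+-comm (a i) (a j))
                            (subst (λ x → a j + a x ≡ c) (∸-mirror i+j≡c) (paired j (right-mirror i+j≡c e<i)))
    ... | centre m≤i i≤e with m≤j , j≤e ← centre-mirror i+j≡c m≤i i≤e = begin
      a i + a j                ≡⟨ cong₂ (λ x y → a x + a y) (centre⇒≡m m≤i i≤e) (centre⇒≡m m≤j j≤e) ⟩
      a m + a m                ≡⟨ cong₂ _+_ (middle e≡m) (middle e≡m) ⟩
      m + m                    ≡⟨ cong (m +_) e≡m ⟨
      c                        ∎
      where
      open ≡-Reasoning
      e≡m = centre⇒e≡m m≤i i≤e

    s! : ∀ {i} → i < m → s ! i ≡ a i
    s! = take-! m t

    length-s : length s ≡ m
    length-s = trans (length-take m t) (m≤n⇒m⊓n≡m (subst (m ≤_) (sym len-t) (<⇒≤ m<n)))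

    extendList-s : extendList s ≡ t
    extendList-s = !-ext (trans (length-applyUpTo (extend s) n) (sym len-t)) λ i i<n′ →
      let i<n = subst (i <_) (length-applyUpTo (extend s) n) i<n′ in
      trans (extendList-! s i<n) (sym (a≡extend i (≤-pred i<n)))
      where
      a≡extend : ∀ i → i ≤ c → a i ≡ extend s i
      a≡extend i i≤c with region i
      ... | left i<m       = sym (s! i<m)
      ... | centre m≤i i≤e = trans (cong a (centre⇒≡m m≤i i≤e)) (middle (centre⇒e≡m m≤i i≤e))
      ... | right e<i      = begin
        a i                                      ≡⟨ m+n∸n≡m (a i) (a (c ∸ i)) ⟨
        a i + a (c ∸ i) ∸ a (c ∸ i)              ≡⟨ cong (_∸ a (c ∸ i)) (complementary⇒paired {a = a} t-comp i i≤c) ⟩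
        c ∸ a (c ∸ i)                            ≡⟨ cong (c ∸_) (s! (right-mirror (m+[n∸m]≡n i≤c) e<i)) ⟨
        c ∸ s ! (c ∸ i)                          ∎
        where open ≡-Reasoning

    ∈-lists≤-s : s ∈ lists≤ c m
    ∈-lists≤-s = subst (λ l → s ∈ lists≤ c l) length-s (∈-lists≤⁺ c (All-! s λ i i<ℓ →
      let i<m = subst (i <_) length-s i<ℓ in
      subst (_≤ c) (sym (s! i<m)) (complementary⇒≤ {a = a} t-comp i (i<m⇒i≤c i<m))))

    halfSeq-s : HalfSeq s
    halfSeq-s = ((subst (_≤ sum s) (+-comm 1 (m C 2)) (t-strong m (s≤s z≤n) m<n) , T≤me) , (⌈/⌉≤ k T≤mE , last≤e) ,
                 (length-s , s↑ , s-strong , refl , refl))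
      where
      s↑ : NonDecreasing s
      s↑ = AllPairs⇒Linked (AllPairs.take⁺ m (Linked⇒AllPairs ≤-trans t↑))
      s-strong : Strong m s
      s-strong r 1≤r r<m = subst (r C 2 <_) (cong sum (sym (trans (take-take r m t) (cong (λ x → take x t) (m≤n⇒m⊓n≡m (<⇒≤ r<m))))))
                                   (t-strong r 1≤r (<-trans r<m m<n))
      last≤e : s at m ≤ e
      last≤e = subst (_≤ e) (sym (trans (at≡! s k) (s! ≤-refl))) (+-double-≤⇒≤ (begin
        a k + a k            ≤⟨ +-monoʳ-≤ (a k) (!-mono t↑ k≤c∸k (subst (c ∸ k <_) (sym len-t) (s≤s (m∸n≤m c k)))) ⟩
        a k + a (c ∸ k)      ≡⟨ paired k ≤-refl ⟩
        suc (k + e)          ≤⟨ s≤s (+-monoˡ-≤ e k≤e) ⟩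
        suc (e + e)          ∎))
        where
        open ≤-Reasoning
        k≤c∸k = subst (k ≤_) (sym n∸m≡1+e) (≤-trans k≤e (n≤1+n e))
      T≤mE : sum s ≤ m * s at m
      T≤mE = subst (_≤ m * s at m) (sym (trans (sum≡∑< s) (cong (λ l → ∑< l (s !_)) length-s)))
                   (∑<-≤ m (!≤last s↑ length-s))
      T≤me : sum s ≤ m * e
      T≤me = ≤-trans T≤mE (*-monoʳ-≤ m last≤e)

  halfSeqs≡sscSeqs : length (filter halfSeq? (lists≤ c m)) ≡ SSCS n
  halfSeqs≡sscSeqs = length-filter-≡-by-inverses halfSeq? sscSeq? extendList (take m)
    (lists≤-unique c m) (lists≤-unique (n C 2) n) forth back
    where
    forth : ∀ {s} → s ∈ lists≤ c m → HalfSeq s → extendList s ∈ lists≤ (n C 2) n × SSCSeq (extendList s) × take m (extendList s) ≡ s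
    forth {s} _ s-half = scoreSeq∈lists≤ (proj₁ t-sscs) , t-sscs , take-extendList (proj₁ (proj₂ (proj₂ s-half)))
      where t-sscs = extendList-SSCSeq s-half
    back : ∀ {t} → t ∈ lists≤ (n C 2) n → SSCSeq t → take m t ∈ lists≤ c m × HalfSeq (take m t) × extendList (take m t) ≡ t
    back _ t-sscs = ∈-lists≤-s , halfSeq-s , extendList-s
      where open FirstHalf t-sscs

  G≡count : ∀ {T E} → E ≤ e → G m T E ≡ length (filter (gCond? m T E) (lists≤ c m))
  G≡count {T} {E} E≤e = length-filter-lists≤-bound (gCond? m T E) T c m
    (λ { (_ , _ , _ , _ , sum≡T) → subst (λ x → All (_≤ x) _) sum≡T (All≤sum _) })
    (λ { (len , s↑ , _ , last≡E , _) → All-! _ λ i i<ℓ →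
           ≤-trans (!≤last s↑ len i (subst (i <_) len i<ℓ)) (≤-trans (≤-reflexive last≡E) (≤-trans E≤e (m≤n+m e m))) })

  sscs≡∑∑G : SSCS n ≡ ∑[ m C 2 + 1 to m * e ] (λ T → ∑[ ⌈ T / m ⌉ to e ] (λ E → G m T E))
  sscs≡∑∑G = begin
    SSCS n                                                     ≡⟨ halfSeqs≡sscSeqs ⟨
    length (filter halfSeq? (lists≤ c m))                      ≡⟨ ∑-length-filter inRange? sum (λ g → sym (sum≡ g)) (m C 2 + 1) (m * e) (lists≤ c m) ⟨
    ∑[ m C 2 + 1 to m * e ] (λ T → length (filter (inRange? T) (lists≤ c m)))
      ≡⟨ ∑-cong (m C 2 + 1) (m * e) (λ T _ _ → ∑-length-filter (gCond? m T) (_at m) (λ g → sym (last≡ g)) ⌈ T / m ⌉ e (lists≤ c m)) ⟨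
    ∑[ m C 2 + 1 to m * e ] (λ T → ∑[ ⌈ T / m ⌉ to e ] (λ E → length (filter (gCond? m T E) (lists≤ c m))))
      ≡⟨ ∑-cong (m C 2 + 1) (m * e) (λ T _ _ → ∑-cong ⌈ T / m ⌉ e {λ E → G m T E} λ E _ E≤e → G≡count E≤e) ⟨
    ∑[ m C 2 + 1 to m * e ] (λ T → ∑[ ⌈ T / m ⌉ to e ] (λ E → G m T E))  ∎
    where
    open ≡-Reasoning
    InRange : ℕ → List ℕ → Set
    InRange T s = (⌈ T / m ⌉ ≤ s at m × s at m ≤ e) × GCond m T (s at m) s
    inRange? : ∀ T → Decidable (InRange T)
    inRange? T s = ((⌈ T / m ⌉ ≤? s at m) ×-dec (s at m ≤? e)) ×-dec gCond? m T (s at m) s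
    sum≡ : ∀ {T s} → InRange T s → sum s ≡ T
    sum≡ (_ , (_ , _ , _ , _ , sum≡T)) = sum≡T
    last≡ : ∀ {T E s} → GCond m T E s → s at m ≡ E
    last≡ (_ , _ , _ , last≡E , _) = last≡E

theorem12 : (m : ℕ) → .{{_ : NonZero m}} →
    (SSCS (2 * m) ≡ ∑[ m C 2 + 1 to m * (m ∸ 1) ] (λ T → ∑[ ⌈ T / m ⌉ to m ∸ 1 ] (λ E → G m T E)))
    × (SSCS (2 * m + 1) ≡ ∑[ m C 2 + 1 to m * m ] (λ T → ∑[ ⌈ T / m ⌉ to m ] (λ E → G m T E)))
theorem12 (suc k) =
    trans (cong SSCS (even k)) (HalfSequences.sscs≡∑∑G k k ≤-refl (n≤1+n k))
  , trans (cong SSCS (odd k)) (HalfSequences.sscs≡∑∑G k (suc k) (n≤1+n k) ≤-refl)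
  where
  even : ∀ k → 2 * suc k ≡ suc (suc k + k)
  even = solve-∀
  odd : ∀ k → 2 * suc k + 1 ≡ suc (suc k + suc k)
  odd = solve-∀
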